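{- A logical domain $A$ supports quantification if and only if $\mathcal{P}[A]$ is a logical domain.
   Context: Framework. An object generator is a primitive collection of objects with no built-in equality or membership test; a morphism $f\colon A\to B$ assigns an object of $B$ to each object of $A$. The logic is assertion-based and excluded middle is not assumed in general. There is a two-element generator $\textsf{y/n}=\{\textsf{yes},\textsf{no}\}$ whose objects can be told apart. A binary function on $A$ is a morphism $A\to\textsf{y/n}$; $\mathcal{P}[A]$ is the generator of all binary functions on $A$; the empty function $\emptyset$ is constantly $\textsf{no}$. A logical domain is a generator $A$ with a binary pairing $A\times A\to\textsf{y/n}$ returning $\textsf{yes}$ exactly when the two arguments are the same object. A logical domain $A$ supports quantification if there is a binary function $\mathcal{P}[A]\to\textsf{y/n}$ returning $\textsf{yes}$ exactly on $\emptyset$. -}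

module Defs where

open import Data.Bool using (Bool; true; false)
open import Relation.Binary.PropositionalEquality using (_≡_)
open import Function.Bundles using (_⇔_)
open import Data.Product using (Σ)

-- y/n is Bool (yes = true, no = false).
record IsLogicalDomain (X : Set) (_≈_ : X → X → Set) : Set where
  field
    same   : X → X → Bool
    same-spec : ∀ x y → (same x y ≡ true) ⇔ (x ≈ y)

LogicalDomain : Set → Set
LogicalDomain A = IsLogicalDomain A _≡_

-- P[A]: all binary functions A → y/n.  Two binary functions are the same
-- object when they assign the same value to every object of A.
𝒫 : Set → Set
𝒫 A = A → Bool

_≈𝒫_ : {A : Set} → 𝒫 A → 𝒫 A → Set
f ≈𝒫 g = ∀ a → f a ≡ g a

PowerLogicalDomain : Set → Set
PowerLogicalDomain A = IsLogicalDomain (𝒫 A) _≈𝒫_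

∅ : {A : Set} → 𝒫 A
∅ _ = false

SupportsQuantification : Set → Set
SupportsQuantification A =
  Σ (𝒫 A → Bool) (λ Q → ∀ f → (Q f ≡ true) ⇔ (f ≈𝒫 ∅))

{-# OPTIONS --safe #-}
module Submission where

-- Two binary functions f, g are the same exactly when their pointwise
-- difference f xor g is ∅, so a quantifier Q yields the pairing Q (f xor g) on
-- P[A]; conversely, pairing with ∅ is a quantifier.  Neither direction uses
-- the logical domain structure of A itself.

open import Defs
open import Function.Bundles using (_⇔_; mk⇔)
open import Function.Properties.Equivalence using () renaming (trans to ⇔-trans)
open import Data.Bool using (Bool; true; false; _xor_)
open import Data.Bool.Properties using (xor-same)
open import Data.Product using (_,_)
open import Relation.Binary.PropositionalEquality using (_≡_; refl)

xor≡false⇒≡ : ∀ b c → b xor c ≡ false → b ≡ c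
xor≡false⇒≡ true  true  _ = refl
xor≡false⇒≡ false false _ = refl

≡⇒xor≡false : ∀ b c → b ≡ c → b xor c ≡ false
≡⇒xor≡false b .b refl = xor-same b

_⊕_ : {A : Set} → 𝒫 A → 𝒫 A → 𝒫 A
(f ⊕ g) a = f a xor g a

⊕≈∅⇔≈ : {A : Set} (f g : 𝒫 A) → (f ⊕ g) ≈𝒫 ∅ ⇔ f ≈𝒫 g
⊕≈∅⇔≈ f g = mk⇔
  (λ f⊕g≈∅ a → xor≡false⇒≡ (f a) (g a) (f⊕g≈∅ a))
  (λ f≈g a → ≡⇒xor≡false (f a) (g a) (f≈g a))

quantification⇒powerLogicalDomain :
  (A : Set) → SupportsQuantification A → PowerLogicalDomain A
quantification⇒powerLogicalDomain A (Q , Q-spec) = record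
  { same      = λ f g → Q (f ⊕ g)
  ; same-spec = λ f g → ⇔-trans (Q-spec (f ⊕ g)) (⊕≈∅⇔≈ f g)
  }

powerLogicalDomain⇒quantification :
  (A : Set) → PowerLogicalDomain A → SupportsQuantification A
powerLogicalDomain⇒quantification A ld = (λ f → same f ∅) , (λ f → same-spec f ∅)
  where open IsLogicalDomain ld

mainTheorem3 : (A : Set) → LogicalDomain A →
    SupportsQuantification A ⇔ PowerLogicalDomain A
mainTheorem3 A _ =
  mk⇔ (quantification⇒powerLogicalDomain A) (powerLogicalDomain⇒quantification A)
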